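{- Let $n\ge 3$. Suppose that every finite simple connected graph $G$ with $n$ vertices and $n+1$ edges satisfies $N(P_G)\le M(n)$. Then every finite simple connected graph $G'$ with $n+1$ vertices and $n+2$ edges that has at least one vertex of degree one satisfies $N(P_{G'})\le M(n+1)$.
   Context: For a finite simple graph $G$ on vertex set $[n]$, $P_G=\operatorname{conv}\{\pm(e_i-e_j):\{i,j\}\in E(G)\}\subset\mathbb{R}^n$ is the symmetric edge polytope, and $N(P)$ is the number of facets of a polytope $P$. $M(n)$ is given by $M(2k-1)=(k+1)(k-1)\binom{k}{k/2}\binom{k-2}{(k-2)/2}$ for $k$ even, $M(2k-1)=k^2\binom{k-1}{(k-1)/2}^2$ for $k$ odd, and $M(2k)=2M(2k-1)$; for $n\ge5$ this equals $N(P_G)$ for $G=C_{k+1}\vee C_{k-1}$ ($n=2k-1$, $k$ even), $C_k\vee C_k$ ($n=2k-1$, $k$ odd), $C_{k+1}\vee C_{k-1}\vee e$ ($n=2k$, $k$ even), $C_k\vee C_k\vee e$ ($n=2k$, $k$ odd), where $C_m$ is the $m$-edge cycle, $e$ a single edge and $\vee$ a one-vertex identification (wedge). -}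

module Defs where

open import Data.Nat as ℕ using (ℕ; zero; suc; _≤_; _*_; _∸_; _/_; _%_)
open import Data.Nat.Combinatorics using (_C_)
open import Data.Bool using (Bool; true; false; if_then_else_)
open import Data.Fin using (Fin; _<_; _≟_)
open import Data.List using (List; []; _∷_; length; filter; foldr; map; concatMap; lookup; allFin)
open import Data.List.Relation.Unary.All using (All)
open import Data.List.Relation.Unary.Unique.Propositional using (Unique)
open import Data.Product using (Σ; ∃; _×_; _,_)
open import Data.Fin.Subset using (Subset; _∈_; _∉_; _⊆_)
open import Data.Rational as ℚ using (ℚ; 0ℚ; 1ℚ)
open import Relation.Binary.PropositionalEquality using (_≡_)
open import Relation.Nullary using (¬_; does)
open import Function.Bundles using (_⇔_)

record Graph (n : ℕ) : Set where
  field
    adj     : Fin n → Fin n → Bool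
    sym     : ∀ i j → adj i j ≡ adj j i
    irrefl  : ∀ i → adj i i ≡ false
open Graph public

edges : ∀ {n} → Graph n → List (Fin n × Fin n)
edges {n} G =
  concatMap (λ i → map (λ j → (i , j))
                       (filter (λ j → Data.Fin._<?_ i j) (filter (λ j → adj G i j ≟b true) (allFin n))))
            (allFin n)
  where
    open import Data.Bool.Properties renaming (_≟_ to _≟b_)
    import Data.Fin

numEdges : ∀ {n} → Graph n → ℕ
numEdges G = length (edges G)

degree : ∀ {n} → Graph n → Fin n → ℕ
degree {n} G v = length (filter (λ u → adj G v u ≟b true) (allFin n))
  where open import Data.Bool.Properties renaming (_≟_ to _≟b_)

data Reach {n : ℕ} (G : Graph n) : Fin n → Fin n → Set where
  here : ∀ {u} → Reach G u u
  step : ∀ {u v w} → adj G u v ≡ true → Reach G v w → Reach G u w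

Connected : ∀ {n} → Graph n → Set
Connected {n} G = ∀ (u v : Fin n) → Reach G u v

-- Polytopes given as convex hulls of a finite list of points in ℚ^n,
-- their faces (argmax sets of linear functionals) and facets
-- (inclusion-maximal proper faces).

Point : ℕ → Set
Point n = Fin n → ℚ

dot : ∀ {n} → Point n → Point n → ℚ
dot {n} a p = foldr (λ k acc → a k ℚ.* p k ℚ.+ acc) 0ℚ (allFin n)

unit : ∀ {n} → Fin n → Point n
unit i k = if does (i ≟ k) then 1ℚ else 0ℚ

-- generating points of the symmetric edge polytope: ±(e_i - e_j)
sepPoints : ∀ {n} → Graph n → List (Point n)
sepPoints G =
  concatMap (λ { (i , j) → (λ k → unit i k ℚ.- unit j k) ∷ (λ k → unit j k ℚ.- unit i k) ∷ [] })
            (edges G)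

module _ {n : ℕ} (pts : List (Point n)) where
  private
    k = length pts
    pt : Fin k → Point n
    pt = lookup pts

  InArgmax : Point n → Fin k → Set
  InArgmax a i = ∀ (j : Fin k) → dot a (pt j) ℚ.≤ dot a (pt i)

  IsFaceBy : Point n → Subset k → Set
  IsFaceBy a S = ∀ (i : Fin k) → (i ∈ S) ⇔ InArgmax a i

  IsFace : Subset k → Set
  IsFace S = Σ (Point n) (λ a → IsFaceBy a S)

  Proper : Subset k → Set
  Proper S = Σ (Fin k) (λ i → i ∉ S)

  IsFacet : Subset k → Set
  IsFacet S = IsFace S × Proper S × (∀ T → IsFace T → Proper T → S ⊆ T → T ≡ S)

  NumFacets≤ : ℕ → Set
  NumFacets≤ m = ∀ (L : List (Subset k)) → Unique L → All IsFacet L → length L ≤ m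

SEPFacets≤ : ∀ {n} → Graph n → ℕ → Set
SEPFacets≤ G m = NumFacets≤ (sepPoints G) m

-- Mk k = M(2k-1)
Mk : ℕ → ℕ
Mk k with k % 2
... | 0 = (suc k) * (k ∸ 1) * (k C (k / 2)) * ((k ∸ 2) C ((k ∸ 2) / 2))
... | _ = k * k * ((k ∸ 1) C ((k ∸ 1) / 2)) * ((k ∸ 1) C ((k ∸ 1) / 2))

M : ℕ → ℕ
M n with n % 2
... | 0 = 2 * Mk (n / 2)
... | _ = Mk ((suc n) / 2)

-- Deleting the leaf v of G' leaves a connected graph G with n vertices and n + 1 edges.
-- Every facet of P_G' is the face of some functional a; it contains exactly one of the two
-- pendant vertices ±(e_u' − e_v) (u' the neighbour of v), and a restricted to the coordinates
-- of G cuts out a facet of P_G.  Conversely any functional of G lifts, with a suitable value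
-- at v, to a functional of G' whose face contains the given face and the chosen pendant
-- vertex; maximality of facets turns this into: a facet of P_G' is determined by its
-- restriction and the sign of its pendant vertex.  Hence N(P_G') ≤ 2 N(P_G) ≤ 2 M(n), and
-- 2 M(n) ≤ M(n + 1) reduces to the growth of consecutive central binomial coefficients.

module Submission where

open import Defs hiding (sym; irrefl)
open import Data.Fin using (Fin)
open import Data.Nat using (ℕ; suc)
open import Relation.Binary.PropositionalEquality using (_≡_)

module GrowthOfM where

  open import Data.Nat
  open import Data.Nat.Combinatorics
  open import Data.Nat.DivMod
  open import Data.Nat.Properties
  open import Data.Nat.Tactic.RingSolver using (solve-∀)
  open import Relation.Binary.PropositionalEquality

  nCk*k![n∸k]!≡n! : ∀ {n k} → k ≤ n → (n C k) * (k ! * (n ∸ k) !) ≡ n !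
  nCk*k![n∸k]!≡n! {n} {k} k≤n = begin
    (n C k) * (k ! * (n ∸ k) !)                  ≡⟨ cong (_* (k ! * (n ∸ k) !)) (nCk≡n!/k![n-k]! k≤n) ⟩
    n ! / (k ! * (n ∸ k) !) * (k ! * (n ∸ k) !)  ≡⟨ m/n*n≡m (k![n∸k]!∣n! k≤n) ⟩
    n !                                          ∎
    where
    open ≡-Reasoning
    instance _ = k !* (n ∸ k) !≢0

  [i*2]Ci*i!*i!≡[i*2]! : ∀ i → ((i * 2) C i) * (i ! * i !) ≡ (i * 2) !
  [i*2]Ci*i!*i!≡[i*2]! i = begin
    ((i * 2) C i) * (i ! * i !)            ≡⟨ cong (λ m → ((i * 2) C i) * (i ! * m !)) [i*2]∸i≡i ⟨
    ((i * 2) C i) * (i ! * (i * 2 ∸ i) !)  ≡⟨ nCk*k![n∸k]!≡n! (m≤m*n i 2) ⟩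
    (i * 2) !                              ∎
    where
    open ≡-Reasoning
    [i*2]∸i≡i : i * 2 ∸ i ≡ i
    [i*2]∸i≡i = trans (cong (_∸ i) (i*2≡i+i i)) (m+n∸n≡m i i)
      where
      i*2≡i+i : ∀ i → i * 2 ≡ i + i
      i*2≡i+i = solve-∀

  centralBinomial-suc : ∀ i → suc i * ((suc i * 2) C suc i) ≡ 2 * suc (i * 2) * ((i * 2) C i)
  centralBinomial-suc i = *-cancelʳ-≡ _ _ (suc i * (i ! * i !)) (begin
    suc i * c′ * (suc i * (i ! * i !))
      ≡⟨ regroupˡ i c′ (i !) ⟩
    c′ * (suc i ! * suc i !)
      ≡⟨ [i*2]Ci*i!*i!≡[i*2]! (suc i) ⟩
    suc (suc (i * 2)) * (suc (i * 2) * (i * 2) !)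
      ≡⟨ cong (λ m → suc (suc (i * 2)) * (suc (i * 2) * m)) ([i*2]Ci*i!*i!≡[i*2]! i) ⟨
    suc (suc (i * 2)) * (suc (i * 2) * (c * (i ! * i !)))
      ≡⟨ regroupʳ i c (i !) ⟩
    2 * suc (i * 2) * c * (suc i * (i ! * i !)) ∎)
    where
    open ≡-Reasoning
    c c′ : ℕ
    c  = (i * 2) C i
    c′ = (suc i * 2) C suc i
    regroupˡ : ∀ i c f → suc i * c * (suc i * (f * f)) ≡ c * (suc i * f * (suc i * f))
    regroupˡ = solve-∀
    regroupʳ : ∀ i c f →
      suc (suc (i * 2)) * (suc (i * 2) * (c * (f * f))) ≡ 2 * suc (i * 2) * c * (suc i * (f * f))
    regroupʳ = solve-∀
    instance
      _ = i !≢0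
      _ = m*n≢0 (i !) (i !)
      _ = m*n≢0 (suc i) (i ! * i !)

  centralBinomial-growth : ∀ i →
    4 * suc (i * 2) * ((i * 2) C i) ≤ suc (suc (suc (i * 2))) * ((suc i * 2) C suc i)
  centralBinomial-growth i = begin
    4 * suc (i * 2) * c           ≡⟨ regroupˡ i c ⟩
    2 * (2 * suc (i * 2) * c)     ≡⟨ cong (2 *_) (centralBinomial-suc i) ⟨
    2 * (suc i * c′)              ≡⟨ regroupʳ i c′ ⟩
    suc (suc (i * 2)) * c′        ≤⟨ *-monoˡ-≤ c′ (n≤1+n (suc (suc (i * 2)))) ⟩
    suc (suc (suc (i * 2))) * c′  ∎
    where
    open ≤-Reasoning
    c c′ : ℕ
    c  = (i * 2) C i
    c′ = (suc i * 2) C suc i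
    regroupˡ : ∀ i c → 4 * suc (i * 2) * c ≡ 2 * (2 * suc (i * 2) * c)
    regroupˡ = solve-∀
    regroupʳ : ∀ i c → 2 * (suc i * c) ≡ suc (suc (i * 2)) * c
    regroupʳ = solve-∀

  data EvenOdd : ℕ → Set where
    even : ∀ j → EvenOdd (j * 2)
    odd  : ∀ j → EvenOdd (suc (j * 2))

  evenOdd : ∀ n → EvenOdd n
  evenOdd zero = even 0
  evenOdd (suc n) with evenOdd n
  ... | even j = odd j
  ... | odd j  = even (suc j)

  private
    Mk-even-index : ∀ k → k % 2 ≡ 0 → Mk k ≡ suc k * (k ∸ 1) * (k C (k / 2)) * ((k ∸ 2) C ((k ∸ 2) / 2))
    Mk-even-index k _ with k % 2
    ... | zero = refl

    Mk-odd-index : ∀ k → k % 2 ≡ 1 → Mk k ≡ k * k * ((k ∸ 1) C ((k ∸ 1) / 2)) * ((k ∸ 1) C ((k ∸ 1) / 2))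
    Mk-odd-index k _ with k % 2
    ... | suc _ = refl

    M-even-index : ∀ n → n % 2 ≡ 0 → M n ≡ 2 * Mk (n / 2)
    M-even-index n _ with n % 2
    ... | zero = refl

    M-odd-index : ∀ n → n % 2 ≡ 1 → M n ≡ Mk (suc n / 2)
    M-odd-index n _ with n % 2
    ... | suc _ = refl

    [j*2]/2≡j : ∀ j → j * 2 / 2 ≡ j
    [j*2]/2≡j j = m*n/n≡m j 2

    [j*2]%2≡0 : ∀ j → j * 2 % 2 ≡ 0
    [j*2]%2≡0 j = m*n%n≡0 j 2

    [1+j*2]%2≡1 : ∀ j → suc (j * 2) % 2 ≡ 1
    [1+j*2]%2≡1 j = [m+kn]%n≡m%n 1 j 2

  Mk-odd : ∀ i → Mk (suc (i * 2)) ≡ suc (i * 2) * suc (i * 2) * ((i * 2) C i) * ((i * 2) C i)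
  Mk-odd i rewrite Mk-odd-index (suc (i * 2)) ([1+j*2]%2≡1 i) | [j*2]/2≡j i = refl

  Mk-even : ∀ i →
    Mk (suc i * 2) ≡ suc (suc (suc (i * 2))) * suc (i * 2) * ((suc i * 2) C suc i) * ((i * 2) C i)
  Mk-even i
    rewrite Mk-even-index (suc i * 2) ([j*2]%2≡0 (suc i)) | [j*2]/2≡j (suc i) | [j*2]/2≡j i = refl

  M-even : ∀ j → M (j * 2) ≡ 2 * Mk j
  M-even j rewrite M-even-index (j * 2) ([j*2]%2≡0 j) | [j*2]/2≡j j = refl

  M-odd : ∀ j → M (suc (j * 2)) ≡ Mk (suc j)
  M-odd j rewrite M-odd-index (suc (j * 2)) ([1+j*2]%2≡1 j) | [j*2]/2≡j (suc j) = refl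

  Mk-step : ∀ j → 1 ≤ j → 2 * (2 * Mk j) ≤ Mk (suc j)
  Mk-step j 1≤j with evenOdd j
  ... | odd i rewrite Mk-odd i | Mk-even i = begin
    2 * (2 * (X * X * c * c))  ≡⟨ regroupˡ X c ⟩
    (X * c) * (4 * X * c)      ≤⟨ *-monoʳ-≤ (X * c) (centralBinomial-growth i) ⟩
    (X * c) * (Y * c′)         ≡⟨ regroupʳ X Y c c′ ⟩
    Y * X * c′ * c             ∎
    where
    open ≤-Reasoning
    X Y c c′ : ℕ
    X = suc (i * 2) ; Y = suc (suc (suc (i * 2))) ; c = (i * 2) C i ; c′ = (suc i * 2) C suc i
    regroupˡ : ∀ X c → 2 * (2 * (X * X * c * c)) ≡ (X * c) * (4 * X * c)
    regroupˡ = solve-∀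
    regroupʳ : ∀ X Y c c′ → (X * c) * (Y * c′) ≡ Y * X * c′ * c
    regroupʳ = solve-∀
  ... | even (suc i) rewrite Mk-even i | Mk-odd (suc i) = begin
    2 * (2 * (Y * X * c′ * c)) ≡⟨ regroupˡ X Y c c′ ⟩
    (Y * c′) * (4 * X * c)     ≤⟨ *-monoʳ-≤ (Y * c′) (centralBinomial-growth i) ⟩
    (Y * c′) * (Y * c′)        ≡⟨ regroupʳ Y c′ ⟩
    Y * Y * c′ * c′            ∎
    where
    open ≤-Reasoning
    X Y c c′ : ℕ
    X = suc (i * 2) ; Y = suc (suc (suc (i * 2))) ; c = (i * 2) C i ; c′ = (suc i * 2) C suc i
    regroupˡ : ∀ X Y c c′ → 2 * (2 * (Y * X * c′ * c)) ≡ (Y * c′) * (4 * X * c)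
    regroupˡ = solve-∀
    regroupʳ : ∀ Y c′ → (Y * c′) * (Y * c′) ≡ Y * Y * c′ * c′
    regroupʳ = solve-∀

  M-step : ∀ n → 3 ≤ n → 2 * M n ≤ M (suc n)
  M-step n 3≤n with evenOdd n
  ... | odd j rewrite M-odd j | M-even (suc j) = ≤-refl
  ... | even (suc j) rewrite M-even (suc j) | M-odd (suc j) = Mk-step (suc j) (s≤s z≤n)

module VertexDeletion where

  open import Algebra.Properties.CommutativeMonoid.Sum as MonoidSum using ()
  open import Data.Bool using (Bool; true; false; _∧_)
  open import Data.Bool.Properties using () renaming (_≟_ to _≟ᵇ_)
  open import Data.Empty using (⊥-elim)
  open import Data.Fin as Fin using (zero; suc; punchIn; punchOut; _<?_)
  open import Data.Fin.Properties as Finₚ using (punchInᵢ≢i; punchIn-punchOut; punchIn-injective)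
  open import Data.List using (List; []; _∷_; length; map; filter; concatMap; tabulate; allFin)
  open import Data.List.Membership.Propositional using (_∈_)
  open import Data.List.Membership.Propositional.Properties using (∈-filter⁺; ∈-filter⁻; ∈-allFin)
  open import Data.List.Properties using (length-map; length-++)
  open import Data.List.Relation.Unary.Any using (here)
  open import Data.Nat using (zero; suc; _+_)
  open import Data.Nat.Properties as ℕₚ using (+-0-commutativeMonoid; +-assoc; +-comm)
  open import Data.Product using (∃; _×_; _,_; proj₁; proj₂)
  open import Function using (_∘_; _⇔_; mk⇔)
  open import Level using (0ℓ)
  open import Relation.Binary.Definitions using (tri<; tri≈; tri>)
  open import Relation.Binary.PropositionalEquality
  open import Relation.Nullary using (yes; no; does)
  open import Relation.Nullary.Decidable using (does-⇔; dec-true; dec-false)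
  open import Relation.Unary using (Pred; Decidable)

  open MonoidSum +-0-commutativeMonoid using (sum; sum-syntax; sum-remove; ∑-distrib-+; sum-cong-≗)

  fromBool : Bool → ℕ
  fromBool true  = 1
  fromBool false = 0

  module _ {A : Set} where

    length-filter-tabulate : ∀ {P : Pred A 0ℓ} (P? : Decidable P) {n} (g : Fin n → A) →
      length (filter P? (tabulate g)) ≡ ∑[ k < n ] fromBool (does (P? (g k)))
    length-filter-tabulate P? {zero}  g = refl
    length-filter-tabulate P? {suc n} g with does (P? (g zero))
    ... | true  = cong suc (length-filter-tabulate P? (g ∘ suc))
    ... | false = length-filter-tabulate P? (g ∘ suc)

    length-filter-filter-tabulate : ∀ {P Q : Pred A 0ℓ} (P? : Decidable P) (Q? : Decidable Q) {n}
      (g : Fin n → A) →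
      length (filter P? (filter Q? (tabulate g))) ≡ ∑[ k < n ] fromBool (does (Q? (g k)) ∧ does (P? (g k)))
    length-filter-filter-tabulate P? Q? {zero}  g = refl
    length-filter-filter-tabulate P? Q? {suc n} g with does (Q? (g zero))
    ... | false = length-filter-filter-tabulate P? Q? (g ∘ suc)
    ... | true with does (P? (g zero))
    ...   | true  = cong suc (length-filter-filter-tabulate P? Q? (g ∘ suc))
    ...   | false = length-filter-filter-tabulate P? Q? (g ∘ suc)

    length-concatMap-tabulate : ∀ {B : Set} (f : A → List B) {n} (g : Fin n → A) →
      length (concatMap f (tabulate g)) ≡ ∑[ k < n ] length (f (g k))
    length-concatMap-tabulate f {zero}  g = refl
    length-concatMap-tabulate f {suc n} g =
      trans (length-++ (f (g zero))) (cong (length (f (g zero)) +_) (length-concatMap-tabulate f (g ∘ suc)))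

  ∑∑-removeAt : ∀ {n} (f : Fin (suc n) → Fin (suc n) → ℕ) v →
    ∑[ i < suc n ] ∑[ j < suc n ] f i j ≡
    f v v + (∑[ j < n ] (f v (punchIn v j) + f (punchIn v j) v)
             + ∑[ i < n ] ∑[ j < n ] f (punchIn v i) (punchIn v j))
  ∑∑-removeAt {n} f v = begin
    ∑[ i < suc n ] ∑[ j < suc n ] f i j
      ≡⟨ sum-remove (λ i → ∑[ j < suc n ] f i j) ⟩
    ∑[ j < suc n ] f v j + ∑[ i < n ] ∑[ j < suc n ] f (pI i) j
      ≡⟨ cong₂ _+_ (sum-remove (f v)) (sum-cong-≗ (λ i → sum-remove (f (pI i)))) ⟩
    (f v v + ∑[ j < n ] f v (pI j)) + ∑[ i < n ] (f (pI i) v + ∑[ j < n ] f (pI i) (pI j))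
      ≡⟨ cong ((f v v + ∑[ j < n ] f v (pI j)) +_) (∑-distrib-+ (λ i → f (pI i) v) _) ⟩
    (f v v + ∑[ j < n ] f v (pI j)) + (∑[ i < n ] f (pI i) v + rest)
      ≡⟨ +-assoc (f v v) _ _ ⟩
    f v v + (∑[ j < n ] f v (pI j) + (∑[ i < n ] f (pI i) v + rest))
      ≡⟨ cong (f v v +_) (+-assoc (∑[ j < n ] f v (pI j)) _ _) ⟨
    f v v + ((∑[ j < n ] f v (pI j) + ∑[ i < n ] f (pI i) v) + rest)
      ≡⟨ cong (λ s → f v v + (s + rest)) (∑-distrib-+ (λ j → f v (pI j)) _) ⟨
    f v v + (∑[ j < n ] (f v (pI j) + f (pI j) v) + rest) ∎
    where
    open ≡-Reasoning
    pI : Fin n → Fin (suc n)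
    pI = punchIn v
    rest : ℕ
    rest = ∑[ i < n ] ∑[ j < n ] f (pI i) (pI j)

  does-≟true : ∀ b → does (b ≟ᵇ true) ≡ b
  does-≟true true  = refl
  does-≟true false = refl

  edgeIndicator : ∀ {n} → Graph n → Fin n → Fin n → ℕ
  edgeIndicator H i j = fromBool (adj H i j ∧ does (i <? j))

  numEdges≡∑∑edgeIndicator : ∀ {n} (H : Graph n) → numEdges H ≡ ∑[ i < n ] ∑[ j < n ] edgeIndicator H i j
  numEdges≡∑∑edgeIndicator {n} H =
    trans (length-concatMap-tabulate edgesFrom (λ i → i)) (sum-cong-≗ λ i →
      trans (length-map (i ,_) (later i))
            (trans (length-filter-filter-tabulate (i <?_) (λ j → adj H i j ≟ᵇ true) (λ j → j))
                   (sum-cong-≗ λ j → cong (λ b → fromBool (b ∧ does (i <? j))) (does-≟true (adj H i j)))))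
    where
    later : Fin n → List (Fin n)
    later i = filter (i <?_) (filter (λ j → adj H i j ≟ᵇ true) (allFin n))
    edgesFrom : Fin n → List (Fin n × Fin n)
    edgesFrom i = map (i ,_) (later i)

  degree≡∑adj : ∀ {n} (H : Graph n) v → degree H v ≡ ∑[ j < n ] fromBool (adj H v j)
  degree≡∑adj H v = trans (length-filter-tabulate (λ u → adj H v u ≟ᵇ true) (λ j → j))
                          (sum-cong-≗ (cong fromBool ∘ does-≟true ∘ adj H v))

  private
    ∧-split : ∀ b → fromBool (b ∧ true) + fromBool (b ∧ false) ≡ fromBool b
    ∧-split true  = refl
    ∧-split false = refl

  edgeIndicator-swap : ∀ {n} (H : Graph n) {i j} → i ≢ j →
    edgeIndicator H i j + edgeIndicator H j i ≡ fromBool (adj H i j)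
  edgeIndicator-swap H {i} {j} i≢j rewrite Graph.sym H j i with Finₚ.<-cmp i j
  ... | tri< i<j _ _ rewrite dec-true (i <? j) i<j | dec-false (j <? i) (Finₚ.<-asym i<j) = ∧-split (adj H i j)
  ... | tri≈ _ i≡j _ = ⊥-elim (i≢j i≡j)
  ... | tri> _ _ j<i rewrite dec-false (i <? j) (Finₚ.<-asym j<i) | dec-true (j <? i) j<i =
    trans (+-comm (fromBool (adj H i j ∧ false)) _) (∧-split (adj H i j))

  punchIn-<-⇔ : ∀ {n} (v : Fin (suc n)) {i j} → (i Fin.< j) ⇔ (punchIn v i Fin.< punchIn v j)
  punchIn-<-⇔ v {i} {j} = mk⇔
    (λ i<j → Finₚ.≤∧≢⇒< (Finₚ.punchIn-mono-≤ v i j (ℕₚ.<⇒≤ i<j)) (Finₚ.<⇒≢ i<j ∘ punchIn-injective v i j))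
    (λ i<j → Finₚ.≤∧≢⇒< (Finₚ.punchIn-cancel-≤ v i j (ℕₚ.<⇒≤ i<j)) (Finₚ.<⇒≢ i<j ∘ cong (punchIn v)))

  deleteVertex : ∀ {n} → Graph (suc n) → Fin (suc n) → Graph n
  deleteVertex G v = record
    { adj    = λ i j → adj G (punchIn v i) (punchIn v j)
    ; sym    = λ i j → Graph.sym G (punchIn v i) (punchIn v j)
    ; irrefl = λ i → Graph.irrefl G (punchIn v i)
    }

  module _ {n} (G : Graph (suc n)) (v : Fin (suc n)) where

    private
      pI : Fin n → Fin (suc n)
      pI = punchIn v

    degree≡∑punchIn : degree G v ≡ ∑[ j < n ] fromBool (adj G v (pI j))
    degree≡∑punchIn = trans (degree≡∑adj G v) (trans (sum-remove (fromBool ∘ adj G v))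
      (cong (λ b → fromBool b + ∑[ j < n ] fromBool (adj G v (pI j))) (Graph.irrefl G v)))

    edgeIndicator-punchIn : ∀ i j → edgeIndicator G (pI i) (pI j) ≡ edgeIndicator (deleteVertex G v) i j
    edgeIndicator-punchIn i j =
      cong (λ c → fromBool (adj G (pI i) (pI j) ∧ c)) (sym (does-⇔ (punchIn-<-⇔ v) (i <? j) (pI i <? pI j)))

    numEdges-deleteVertex : numEdges G ≡ degree G v + numEdges (deleteVertex G v)
    numEdges-deleteVertex = begin
      numEdges G
        ≡⟨ numEdges≡∑∑edgeIndicator G ⟩
      ∑[ i < suc n ] ∑[ j < suc n ] edgeIndicator G i j
        ≡⟨ ∑∑-removeAt (edgeIndicator G) v ⟩
      edgeIndicator G v v + (∑[ j < n ] (edgeIndicator G v (pI j) + edgeIndicator G (pI j) v)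
                             + ∑[ i < n ] ∑[ j < n ] edgeIndicator G (pI i) (pI j))
        ≡⟨ cong₂ (λ b s → fromBool (b ∧ does (v <? v)) + s) (Graph.irrefl G v)
                 (cong₂ _+_ (sum-cong-≗ λ j → edgeIndicator-swap G (punchInᵢ≢i v j ∘ sym))
                            (sum-cong-≗ λ i → sum-cong-≗ (edgeIndicator-punchIn i))) ⟩
      ∑[ j < n ] fromBool (adj G v (pI j)) + ∑[ i < n ] ∑[ j < n ] edgeIndicator (deleteVertex G v) i j
        ≡⟨ cong₂ _+_ degree≡∑punchIn (numEdges≡∑∑edgeIndicator (deleteVertex G v)) ⟨
      degree G v + numEdges (deleteVertex G v) ∎
      where open ≡-Reasoning

  module Leaf {n : ℕ} (G' : Graph (suc n)) (v : Fin (suc n)) (degree≡1 : degree G' v ≡ 1) where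

    G : Graph n
    G = deleteVertex G' v

    private
      adjacent? : Decidable (λ w → adj G' v w ≡ true)
      adjacent? w = adj G' v w ≟ᵇ true

      singleton : ∀ {A : Set} (xs : List A) → length xs ≡ 1 → ∃ λ x → xs ≡ x ∷ []
      singleton (x ∷ []) _ = x , refl

      neighbour : ∃ λ u' → filter adjacent? (allFin (suc n)) ≡ u' ∷ []
      neighbour = singleton (filter adjacent? (allFin (suc n))) degree≡1

    u' : Fin (suc n)
    u' = proj₁ neighbour

    private
      neighbours≡[u'] : filter adjacent? (allFin (suc n)) ≡ u' ∷ []
      neighbours≡[u'] = proj₂ neighbour

    adj-v-u' : adj G' v u' ≡ true
    adj-v-u' =
      proj₂ (∈-filter⁻ adjacent? {xs = allFin (suc n)} (subst (u' ∈_) (sym neighbours≡[u']) (here refl)))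

    neighbour-unique : ∀ {w} → adj G' v w ≡ true → w ≡ u'
    neighbour-unique {w} v~w with subst (w ∈_) neighbours≡[u'] (∈-filter⁺ adjacent? (∈-allFin w) v~w)
    ... | here w≡u' = w≡u'

    u'≢v : u' ≢ v
    u'≢v u'≡v with trans (sym adj-v-u') (trans (cong (adj G' v) u'≡v) (Graph.irrefl G' v))
    ... | ()

    u : Fin n
    u = punchOut (u'≢v ∘ sym)

    punchIn-u : punchIn v u ≡ u'
    punchIn-u = punchIn-punchOut _

    numEdges-deleteLeaf : numEdges G' ≡ suc (numEdges G)
    numEdges-deleteLeaf = trans (numEdges-deleteVertex G' v) (cong (_+ numEdges G) degree≡1)

    -- A walk between vertices other than v can only enter v from u' and must leave back to u'.
    reach-avoiding-v : ∀ {x y} → Reach G' x y → ∀ i j → x ≡ punchIn v i → y ≡ punchIn v j → Reach G i j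
    reach-avoiding-v here i j refl y≡j = subst (Reach G i) (punchIn-injective v i j y≡j) here
    reach-avoiding-v (step {x} {w} x~w r) i j x≡i y≡j with w Finₚ.≟ v
    ... | no w≢v = step (subst₂ (λ a b → adj G' a b ≡ true) x≡i (sym (punchIn-punchOut (w≢v ∘ sym))) x~w)
                        (reach-avoiding-v r _ j (sym (punchIn-punchOut _)) y≡j)
    ... | yes refl with r
    ...   | here = ⊥-elim (punchInᵢ≢i v j (sym y≡j))
    ...   | step {_} {w'} v~w' r' = reach-avoiding-v r' i j w'≡i y≡j
      where
      w'≡i : w' ≡ punchIn v i
      w'≡i = trans (neighbour-unique v~w') (trans (sym (neighbour-unique (trans (Graph.sym G' v x) x~w))) x≡i)

    connected-deleteLeaf : Connected G' → Connected G
    connected-deleteLeaf conn i j = reach-avoiding-v (conn (punchIn v i) (punchIn v j)) i j refl refl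

module EdgePolytopes where

  open import Algebra.Properties.CommutativeMonoid.Sum as MonoidSum using ()
  open import Data.Bool using (true; false)
  open import Data.Bool.Properties using () renaming (_≟_ to _≟ᵇ_)
  open import Data.Empty using (⊥-elim)
  open import Data.Fin as Fin using (zero; suc; punchIn; _≟_)
  open import Data.Fin.Properties as Finₚ using (punchInᵢ≢i)
  open import Data.Fin.Subset as Subset using (Subset)
  open import Data.List using (List; length; lookup; filter; foldr; tabulate; allFin)
  import Data.List.Extrema
  open import Data.List.Membership.Propositional using (_∈_; find; lose)
  open import Data.List.Membership.Propositional.Properties
  open import Data.List.Relation.Unary.All as All using ()
  open import Data.List.Relation.Unary.Any as Any using (here; there)
  open import Data.List.Relation.Unary.Any.Properties using (lookup-index)
  open import Data.Nat using (zero; suc)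
  open import Data.Product using (Σ; ∃₂; _×_; _,_; proj₁; proj₂)
  open import Data.Rational using (ℚ; 0ℚ; 1ℚ; _+_; _*_; _-_; -_; _≤_; _<_)
  open import Data.Rational.Properties as ℚₚ using ()
  open import Algebra.Properties.Group ℚₚ.+-0-group using () renaming (⁻¹-involutive to neg-involutive)
  open import Data.Rational.Solver using (module +-*-Solver)
  import Data.Vec as Vec
  import Data.Vec.Properties as Vecₚ
  open import Function using (_∘_; _⇔_; mk⇔; Equivalence)
  open import Relation.Binary.Bundles using (DecTotalOrder)
  open import Relation.Binary.Definitions using (tri<; tri≈; tri>)
  open import Relation.Binary.PropositionalEquality
  open import Relation.Nullary using (Dec; yes; no; does; ¬_)
  open import Relation.Nullary.Decidable using (dec-true; dec-false)
  open +-*-Solver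
  open Equivalence

  private
    module ℚΣ = MonoidSum ℚₚ.+-0-commutativeMonoid
    module ℚExtrema = Data.List.Extrema (DecTotalOrder.totalOrder ℚₚ.≤-decTotalOrder)

  0<p⇒¬0<-p : ∀ {p} → 0ℚ < p → ¬ (0ℚ < - p)
  0<p⇒¬0<-p {p} 0<p 0<-p = ℚₚ.<-asym 0<p (subst (_< 0ℚ) (neg-involutive p) (ℚₚ.neg-antimono-< 0<-p))

  0<p⇒-p<p : ∀ {p} → 0ℚ < p → - p < p
  0<p⇒-p<p 0<p = ℚₚ.<-trans (ℚₚ.neg-antimono-< 0<p) 0<p

  -p≤0⇒0≤p : ∀ {p} → - p ≤ 0ℚ → 0ℚ ≤ p
  -p≤0⇒0≤p {p} -p≤0 = subst (0ℚ ≤_) (neg-involutive p) (ℚₚ.neg-antimono-≤ -p≤0)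

  maximiser : ∀ {k} (f : Fin k → ℚ) → Fin k → Σ (Fin k) λ x → ∀ y → f y ≤ f x
  maximiser {k} f x₀ =
    ℚExtrema.argmax f x₀ (allFin k) , λ y → All.lookup (ℚExtrema.f[xs]≤f[argmax] x₀ (allFin k)) (∈-allFin y)

  fromDec : ∀ {k} {P : Fin k → Set} → (∀ x → Dec (P x)) → Subset k
  fromDec P? = Vec.tabulate (does ∘ P?)

  ∈-fromDec : ∀ {k} {P : Fin k → Set} (P? : ∀ x → Dec (P x)) x → (x Subset.∈ fromDec P?) ⇔ P x
  ∈-fromDec {P = P} P? x = mk⇔ to′ from′
    where
    lookup-fromDec : Vec.lookup (fromDec P?) x ≡ does (P? x)
    lookup-fromDec = Vecₚ.lookup∘tabulate (does ∘ P?) x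
    to′ : x Subset.∈ fromDec P? → P x
    to′ x∈ with P? x | trans (sym lookup-fromDec) (Vecₚ.[]=⇒lookup x∈)
    ... | yes p | _ = p
    from′ : P x → x Subset.∈ fromDec P?
    from′ p = Vecₚ.lookup⇒[]= x _ (trans lookup-fromDec (dec-true (P? x) p))

  module _ {n : ℕ} (i : Fin n) where

    unit-diagonal : unit i i ≡ 1ℚ
    unit-diagonal rewrite dec-true (i ≟ i) refl = refl

    unit-offDiagonal : ∀ {j} → i ≢ j → unit i j ≡ 0ℚ
    unit-offDiagonal {j} i≢j rewrite dec-false (i ≟ j) i≢j = refl

    unit≤1 : ∀ j → unit i j ≤ 1ℚ
    unit≤1 j with does (i ≟ j)
    ... | true  = ℚₚ.≤-refl
    ... | false = ℚₚ.<⇒≤ (ℚₚ.positive⁻¹ 1ℚ)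

    0≤unit : ∀ j → 0ℚ ≤ unit i j
    0≤unit j with does (i ≟ j)
    ... | true  = ℚₚ.<⇒≤ (ℚₚ.positive⁻¹ 1ℚ)
    ... | false = ℚₚ.≤-refl

  dot≡∑ : ∀ {n} (a p : Point n) → dot a p ≡ ℚΣ.sum (λ k → a k * p k)
  dot≡∑ {n} a p = foldr-tabulate (λ k → k)
    where
    foldr-tabulate : ∀ {m} (g : Fin m → Fin n) →
      foldr (λ k acc → a k * p k + acc) 0ℚ (tabulate g) ≡ ℚΣ.sum (λ k → a (g k) * p (g k))
    foldr-tabulate {zero}  g = refl
    foldr-tabulate {suc m} g = cong (a (g zero) * p (g zero) +_) (foldr-tabulate (g ∘ suc))

  ∑-*-unit : ∀ {n} (a : Point n) i → ℚΣ.sum (λ k → a k * unit i k) ≡ a i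
  ∑-*-unit {suc n} a i = begin
    ℚΣ.sum (λ k → a k * unit i k)                              ≡⟨ ℚΣ.sum-remove {i = i} (λ k → a k * unit i k) ⟩
    a i * unit i i + ℚΣ.sum (λ k → a (pI k) * unit i (pI k))  ≡⟨ cong₂ _+_ (cong (a i *_) (unit-diagonal i))
                                                                              (ℚΣ.sum-cong-≗ off-diagonal) ⟩
    a i * 1ℚ + ℚΣ.sum {n} (λ _ → 0ℚ)                         ≡⟨ cong₂ _+_ (ℚₚ.*-identityʳ (a i))
                                                                              (ℚΣ.sum-replicate-zero n) ⟩
    a i + 0ℚ                                                  ≡⟨ ℚₚ.+-identityʳ (a i) ⟩
    a i                                                       ∎
    where
    open ≡-Reasoning
    pI : Fin n → Fin (suc n)
    pI = punchIn i
    off-diagonal : ∀ k → a (pI k) * unit i (pI k) ≡ 0ℚ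
    off-diagonal k = trans (cong (a (pI k) *_) (unit-offDiagonal i (punchInᵢ≢i i k ∘ sym))) (ℚₚ.*-zeroʳ (a (pI k)))

  ∑-*-sub : ∀ {n} (a p q : Point n) →
    ℚΣ.sum (λ k → a k * (p k - q k)) ≡ ℚΣ.sum (λ k → a k * p k) - ℚΣ.sum (λ k → a k * q k)
  ∑-*-sub {zero}  a p q = refl
  ∑-*-sub {suc n} a p q =
    trans (cong (a zero * (p zero - q zero) +_) (∑-*-sub (a ∘ suc) (p ∘ suc) (q ∘ suc)))
          (solve 5 (λ a p q s t → a :* (p :- q) :+ (s :- t) := (a :* p :+ s) :- (a :* q :+ t)) refl
                   (a zero) (p zero) (q zero) _ _)

  edgeVector : ∀ {n} → Fin n → Fin n → Point n
  edgeVector i j k = unit i k - unit j k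

  dot-edgeVector : ∀ {n} (a : Point n) i j → dot a (edgeVector i j) ≡ a i - a j
  dot-edgeVector a i j =
    trans (dot≡∑ a _) (trans (∑-*-sub a (unit i) (unit j)) (cong₂ _-_ (∑-*-unit a i) (∑-*-unit a j)))

  module SymmetricEdgePolytope {n : ℕ} (H : Graph n) where

    points : List (Point n)
    points = sepPoints H

    K : ℕ
    K = length points

    value : Point n → Fin K → ℚ
    value a x = dot a (lookup points x)

    Coincide : Fin K → Fin K → Set
    Coincide x y = ∀ a → value a x ≡ value a y

    private
      adj-edges : ∀ {e} → e ∈ edges H → adj H (proj₁ e) (proj₂ e) ≡ true
      adj-edges e∈ with find (∈-concatMap⁻ _ {xs = allFin n} e∈)
      ... | i , _ , e∈′ with ∈-map⁻ _ e∈′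
      ... | j , j∈ , refl =
        proj₂ (∈-filter⁻ (λ j → adj H i j ≟ᵇ true) {xs = allFin n} (proj₁ (∈-filter⁻ (i Fin.<?_) j∈)))

      edges-adj : ∀ {i j} → adj H i j ≡ true → i Fin.< j → (i , j) ∈ edges H
      edges-adj {i} {j} i~j i<j = ∈-concatMap⁺ _ {xs = allFin n}
        (lose (∈-allFin i) (∈-map⁺ _ (∈-filter⁺ (i Fin.<?_) j∈ i<j)))
        where
        j∈ : j ∈ filter (λ j → adj H i j ≟ᵇ true) (allFin n)
        j∈ = ∈-filter⁺ (λ j → adj H i j ≟ᵇ true) (∈-allFin j) i~j

      endpoints : ∀ x → ∃₂ λ i j → adj H i j ≡ true × lookup points x ≡ edgeVector i j
      endpoints x with find (∈-concatMap⁻ _ {xs = edges H} (∈-lookup {xs = points} x))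
      ... | (i , j) , e∈ , here eq         = i , j , adj-edges e∈ , eq
      ... | (i , j) , e∈ , there (here eq) = j , i , trans (Graph.sym H j i) (adj-edges e∈) , eq

      indexOf : ∀ {p} → p ∈ points → Σ (Fin K) λ x → lookup points x ≡ p
      indexOf p∈ = Any.index p∈ , sym (lookup-index p∈)

      vertex : ∀ {i j} → adj H i j ≡ true → Σ (Fin K) λ x → lookup points x ≡ edgeVector i j
      vertex {i} {j} i~j with Finₚ.<-cmp i j
      ... | tri< i<j _ _ = indexOf (∈-concatMap⁺ _ {xs = edges H} (lose (edges-adj i~j i<j) (here refl)))
      ... | tri≈ _ refl _ with trans (sym i~j) (Graph.irrefl H i)
      ...   | ()
      vertex {i} {j} i~j | tri> _ _ j<i = indexOf (∈-concatMap⁺ _ {xs = edges H}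
        (lose (edges-adj (trans (Graph.sym H j i) i~j) j<i) (there (here refl))))

    opaque
      tail head : Fin K → Fin n
      tail x = proj₁ (endpoints x)
      head x = proj₁ (proj₂ (endpoints x))

      adj-tail-head : ∀ x → adj H (tail x) (head x) ≡ true
      adj-tail-head x = proj₁ (proj₂ (proj₂ (endpoints x)))

      value-tail-head : ∀ a x → value a x ≡ a (tail x) - a (head x)
      value-tail-head a x = trans (cong (dot a) (proj₂ (proj₂ (proj₂ (endpoints x))))) (dot-edgeVector a _ _)

      index : ∀ i j → adj H i j ≡ true → Fin K
      index i j i~j = proj₁ (vertex i~j)

      value-index : ∀ a i j i~j → value a (index i j i~j) ≡ a i - a j
      value-index a i j i~j = trans (cong (dot a) (proj₂ (vertex i~j))) (dot-edgeVector a i j)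

    coincide-index : ∀ {y i j} (i~j : adj H i j ≡ true) → tail y ≡ i → head y ≡ j → Coincide y (index i j i~j)
    coincide-index {y} i~j refl refl a = trans (value-tail-head a y) (sym (value-index a _ _ i~j))

    opposite : Fin K → Fin K
    opposite x = index (head x) (tail x) (trans (Graph.sym H (head x) (tail x)) (adj-tail-head x))

    value-opposite : ∀ a x → value a (opposite x) ≡ - value a x
    value-opposite a x = begin
      value a (opposite x)         ≡⟨ value-index a _ _ _ ⟩
      a (head x) - a (tail x)      ≡⟨ solve 2 (λ p q → q :- p := :- (p :- q)) refl (a (tail x)) (a (head x)) ⟩
      - (a (tail x) - a (head x))  ≡⟨ cong -_ (value-tail-head a x) ⟨
      - value a x                  ∎
      where open ≡-Reasoning

    value-cong : ∀ {a b : Point n} → (∀ k → a k ≡ b k) → ∀ x → value a x ≡ value b x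
    value-cong {a} {b} a≗b x =
      trans (value-tail-head a x) (trans (cong₂ _-_ (a≗b (tail x)) (a≗b (head x))) (sym (value-tail-head b x)))

    Maximises : Point n → Fin K → Set
    Maximises a x = ∀ y → value a y ≤ value a x

    maximises? : ∀ a x → Dec (Maximises a x)
    maximises? a x = Finₚ.all? (λ y → value a y ℚₚ.≤? value a x)

    faceOf : Point n → Subset K
    faceOf a = fromDec (maximises? a)

    faceOf-isFaceBy : ∀ a → IsFaceBy points a (faceOf a)
    faceOf-isFaceBy a = ∈-fromDec (maximises? a)

    module _ (a : Point n) {S : Subset K} (S-face : IsFaceBy points a S) where

      face-closed : ∀ {x y} → value a x ≡ value a y → x Subset.∈ S → y Subset.∈ S
      face-closed {x} {y} ax≡ay x∈S = from (S-face y) (λ w → subst (value a w ≤_) ax≡ay (to (S-face x) x∈S w))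

      -- The points come in opposite pairs, so a face on which a is not positive contains every point.
      face-value-positive : ∀ {y z} → z Subset.∉ S → y Subset.∈ S → 0ℚ < value a y
      face-value-positive {y} {z} z∉S y∈S with 0ℚ ℚₚ.<? value a y
      ... | yes 0<ay = 0<ay
      ... | no 0≮ay = ⊥-elim (z∉S (from (S-face z) λ w → ℚₚ.≤-trans (y-max w) (ℚₚ.≤-trans ay≤0 0≤az)))
        where
        y-max : Maximises a y
        y-max = to (S-face y) y∈S
        ay≤0 : value a y ≤ 0ℚ
        ay≤0 = ℚₚ.≮⇒≥ 0≮ay
        0≤az : 0ℚ ≤ value a z
        0≤az = -p≤0⇒0≤p (subst (_≤ 0ℚ) (value-opposite a z) (ℚₚ.≤-trans (y-max (opposite z)) ay≤0))

    value-unit≤1 : ∀ i x → value (unit i) x ≤ 1ℚ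
    value-unit≤1 i x = begin
      value (unit i) x                   ≡⟨ value-tail-head (unit i) x ⟩
      unit i (tail x) - unit i (head x)  ≤⟨ ℚₚ.+-mono-≤ (unit≤1 i (tail x))
                                                         (ℚₚ.neg-antimono-≤ (0≤unit i (head x))) ⟩
      1ℚ - 0ℚ                            ≡⟨⟩
      1ℚ                                 ∎
      where open ℚₚ.≤-Reasoning

    value-unit-index : ∀ i j i~j → value (unit i) (index i j i~j) ≡ 1ℚ
    value-unit-index i j i~j =
      trans (value-index (unit i) i j i~j) (cong₂ _-_ (unit-diagonal i) (unit-offDiagonal i i≢j))
      where
      i≢j : i ≢ j
      i≢j refl with trans (sym i~j) (Graph.irrefl H i)
      ... | ()

module LeafFacets {n : ℕ} (G' : Graph (suc n)) (v : Fin (suc n)) (degree≡1 : degree G' v ≡ 1) where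

  open import Data.Bool using (Bool; true; false; not)
  open import Data.Bool.Properties using (¬-not) renaming (_≟_ to _≟ᵇ_)
  open import Data.Empty using (⊥-elim)
  open import Data.Fin using (punchIn; punchOut)
  open import Data.Fin.Properties as Finₚ using (punchIn-punchOut)
  open import Data.Fin.Subset as Subset using (Subset)
  open import Data.Fin.Subset.Properties using (_∈?_; ⊆-antisym)
  open import Data.Product using (∃; _,_; proj₁; proj₂)
  open import Data.Rational using (ℚ; 0ℚ; 1ℚ; _+_; _-_; -_; _≤_; _<_)
  open import Data.Rational.Properties as ℚₚ using ()
  open import Data.Rational.Solver using (module +-*-Solver)
  open import Data.Vec.Functional using (insertAt; removeAt)
  open import Data.Vec.Functional.Properties using (insertAt-lookup; insertAt-punchIn)
  open import Function using (_∘_; _⇔_; mk⇔; Equivalence)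
  open import Relation.Binary.PropositionalEquality
  open import Relation.Nullary using (yes; no; does)
  open import Relation.Nullary.Decidable using (dec-true; dec-false)
  open +-*-Solver
  open Equivalence
  open VertexDeletion using (module Leaf)
  open EdgePolytopes
  open Leaf G' v degree≡1

  module A = SymmetricEdgePolytope G'
  module B = SymmetricEdgePolytope G

  pendantValue : Bool → Point (suc n) → ℚ
  pendantValue true  a = a u' - a v
  pendantValue false a = a v - a u'

  pendantValue-not : ∀ s a → pendantValue (not s) a ≡ - pendantValue s a
  pendantValue-not true  a = solve 2 (λ p q → q :- p := :- (p :- q)) refl (a u') (a v)
  pendantValue-not false a = solve 2 (λ p q → p :- q := :- (q :- p)) refl (a u') (a v)

  pendant : Bool → Fin A.K
  pendant true  = A.index u' v (trans (Graph.sym G' u' v) adj-v-u')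
  pendant false = A.index v u' adj-v-u'

  value-pendant : ∀ s a → A.value a (pendant s) ≡ pendantValue s a
  value-pendant true  a = A.value-index a u' v _
  value-pendant false a = A.value-index a v u' adj-v-u'

  embed : Fin B.K → Fin A.K
  embed x = A.index (punchIn v (B.tail x)) (punchIn v (B.head x)) (B.adj-tail-head x)

  value-embed : ∀ a x → A.value a (embed x) ≡ B.value (removeAt a v) x
  value-embed a x = trans (A.value-index a _ _ (B.adj-tail-head x)) (sym (B.value-tail-head (removeAt a v) x))

  data Shape (y : Fin A.K) : Set where
    embedded    : ∀ x → A.Coincide y (embed x) → Shape y
    pendantEdge : ∀ s → A.Coincide y (pendant s) → Shape y

  shape : ∀ y → Shape y
  shape y with A.tail y Finₚ.≟ v | A.head y Finₚ.≟ v
  ... | yes tail≡v | _ = pendantEdge false (A.coincide-index adj-v-u' tail≡v (neighbour-unique v~head))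
    where
    v~head : adj G' v (A.head y) ≡ true
    v~head = subst (λ w → adj G' w (A.head y) ≡ true) tail≡v (A.adj-tail-head y)
  ... | no _ | yes head≡v = pendantEdge true (A.coincide-index _ (neighbour-unique v~tail) head≡v)
    where
    v~tail : adj G' v (A.tail y) ≡ true
    v~tail = subst (λ w → adj G' w (A.tail y) ≡ true) head≡v (trans (Graph.sym G' _ _) (A.adj-tail-head y))
  ... | no tail≢v | no head≢v = embedded x λ a → trans (A.coincide-index i~j tail≡ head≡ a) (begin
    A.value a (A.index (punchIn v i) (punchIn v j) i~j)  ≡⟨ A.value-index a _ _ i~j ⟩
    a (punchIn v i) - a (punchIn v j)                    ≡⟨ B.value-index (removeAt a v) i j i~j ⟨
    B.value (removeAt a v) x                             ≡⟨ value-embed a x ⟨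
    A.value a (embed x)                                  ∎)
    where
    open ≡-Reasoning
    i j : Fin n
    i = punchOut (tail≢v ∘ sym)
    j = punchOut (head≢v ∘ sym)
    tail≡ : A.tail y ≡ punchIn v i
    tail≡ = sym (punchIn-punchOut _)
    head≡ : A.head y ≡ punchIn v j
    head≡ = sym (punchIn-punchOut _)
    i~j : adj G i j ≡ true
    i~j = subst₂ (λ p q → adj G' p q ≡ true) tail≡ head≡ (A.adj-tail-head y)
    x : Fin B.K
    x = B.index i j i~j

  -- The value at v is chosen so that the pendant vector with sign s gets value m.
  liftedValueAtLeaf : Bool → ℚ → ℚ → ℚ
  liftedValueAtLeaf true  cu m = cu - m
  liftedValueAtLeaf false cu m = cu + m

  module Lift (c : Point n) (xc : Fin B.K) (c-max : B.Maximises c xc) (0<m : 0ℚ < B.value c xc) (s : Bool) where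

    m : ℚ
    m = B.value c xc

    c' : Point (suc n)
    c' = insertAt c v (liftedValueAtLeaf s (c u) m)

    value-embed-c' : ∀ x → A.value c' (embed x) ≡ B.value c x
    value-embed-c' x = trans (value-embed c' x) (B.value-cong (insertAt-punchIn c v _) x)

    value-pendant-c' : A.value c' (pendant s) ≡ m
    value-pendant-c' = trans (value-pendant s c') (pendant-lift s)
      where
      insertAt-u' : ∀ t → insertAt c v t u' ≡ c u
      insertAt-u' t = trans (cong (insertAt c v t) (sym punchIn-u)) (insertAt-punchIn c v t u)
      pendant-lift : ∀ s → pendantValue s (insertAt c v (liftedValueAtLeaf s (c u) m)) ≡ m
      pendant-lift true  = trans (cong₂ _-_ (insertAt-u' _) (insertAt-lookup c v _))
                                 (solve 2 (λ p q → p :- (p :- q) := q) refl (c u) m)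
      pendant-lift false = trans (cong₂ _-_ (insertAt-lookup c v _) (insertAt-u' _))
                                 (solve 2 (λ p q → (p :+ q) :- p := q) refl (c u) m)

    value-pendant-not-c' : A.value c' (pendant (not s)) ≡ - m
    value-pendant-not-c' = begin
      A.value c' (pendant (not s))  ≡⟨ value-pendant (not s) c' ⟩
      pendantValue (not s) c'       ≡⟨ pendantValue-not s c' ⟩
      - pendantValue s c'           ≡⟨ cong -_ (value-pendant s c') ⟨
      - A.value c' (pendant s)      ≡⟨ cong -_ value-pendant-c' ⟩
      - m                           ∎
      where open ≡-Reasoning

    value-c'≤m : ∀ y → A.value c' y ≤ m
    value-c'≤m y with shape y
    ... | embedded x y≋ = subst (_≤ m) (sym (trans (y≋ c') (value-embed-c' x))) (c-max x)
    ... | pendantEdge t y≋ with t ≟ᵇ s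
    ...   | yes refl = ℚₚ.≤-reflexive (trans (y≋ c') value-pendant-c')
    ...   | no t≢s rewrite ¬-not t≢s =
      subst (_≤ m) (sym (trans (y≋ c') value-pendant-not-c')) (ℚₚ.<⇒≤ (0<p⇒-p<p 0<m))

    face : Subset A.K
    face = A.faceOf c'

    ∈face : ∀ {y} → m ≤ A.value c' y → y Subset.∈ face
    ∈face m≤c'y = from (A.faceOf-isFaceBy c' _) (λ w → ℚₚ.≤-trans (value-c'≤m w) m≤c'y)

    pendant∈face : pendant s Subset.∈ face
    pendant∈face = ∈face (ℚₚ.≤-reflexive (sym value-pendant-c'))

    face-proper : Proper A.points face
    face-proper = pendant (not s) , λ p∈ → ℚₚ.<-irrefl refl (ℚₚ.<-≤-trans (0<p⇒-p<p 0<m) (begin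
      m                              ≡⟨ value-pendant-c' ⟨
      A.value c' (pendant s)         ≤⟨ to (A.faceOf-isFaceBy c' _) p∈ (pendant s) ⟩
      A.value c' (pendant (not s))   ≡⟨ value-pendant-not-c' ⟩
      - m                            ∎))
      where open ℚₚ.≤-Reasoning

  restrictFace : Subset A.K → Subset B.K
  restrictFace S = fromDec (λ x → embed x ∈? S)

  sign : Subset A.K → Bool
  sign S = does (pendant true ∈? S)

  module Facet (u~w : ∃ λ w → adj G u w ≡ true) {S : Subset A.K} (S-facet : IsFacet A.points S) where

    private
      a : Point (suc n)
      a = proj₁ (proj₁ S-facet)
      S-face : IsFaceBy A.points a S
      S-face = proj₂ (proj₁ S-facet)
      z∉S : proj₁ (proj₁ (proj₂ S-facet)) Subset.∉ S
      z∉S = proj₂ (proj₁ (proj₂ S-facet))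
      S-maximal : ∀ T → IsFace A.points T → Proper A.points T → S Subset.⊆ T → T ≡ S
      S-maximal = proj₂ (proj₂ S-facet)

    b : Point n
    b = removeAt a v

    coincide-∈ : ∀ {y y'} → A.Coincide y y' → y Subset.∈ S → y' Subset.∈ S
    coincide-∈ y≋y' = A.face-closed a S-face (y≋y' a)

    private
      0<value : ∀ {y} → y Subset.∈ S → 0ℚ < A.value a y
      0<value = A.face-value-positive a S-face z∉S

      same-value : ∀ {y y'} → y Subset.∈ S → y' Subset.∈ S → A.value a y ≡ A.value a y'
      same-value y∈S y'∈S = ℚₚ.≤-antisym (to (S-face _) y'∈S _) (to (S-face _) y∈S _)

    pendant-∈⇒sign : ∀ t → pendant t Subset.∈ S → t ≡ sign S
    pendant-∈⇒sign true  p∈S = sym (dec-true (pendant true ∈? S) p∈S)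
    pendant-∈⇒sign false p∈S = sym (dec-false (pendant true ∈? S) λ q∈S →
      0<p⇒¬0<-p (subst (0ℚ <_) (value-pendant true a) (0<value q∈S))
                (subst (0ℚ <_) (trans (value-pendant false a) (pendantValue-not true a)) (0<value p∈S)))

    -- The face of a lift contains S as soon as it contains the points of G lying in S; then it is S by maximality.
    liftFace≡S : ∀ c xc c-max 0<m → (∀ x → embed x Subset.∈ S → B.value c xc ≤ B.value c x) →
                 Lift.face c xc c-max 0<m (sign S) ≡ S
    liftFace≡S c xc c-max 0<m embedded-high = S-maximal L.face (L.c' , A.faceOf-isFaceBy L.c') L.face-proper S⊆face
      where
      module L = Lift c xc c-max 0<m (sign S)
      S⊆face : S Subset.⊆ L.face
      S⊆face {y} y∈S = by-shape (shape y)
        where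
        by-shape : Shape y → y Subset.∈ L.face
        by-shape (embedded x y≋) =
          L.∈face (subst (L.m ≤_) (sym (trans (y≋ L.c') (L.value-embed-c' x))) (embedded-high x (coincide-∈ y≋ y∈S)))
        by-shape (pendantEdge t y≋) = L.∈face (ℚₚ.≤-reflexive (sym (begin
          A.value L.c' y                   ≡⟨ y≋ L.c' ⟩
          A.value L.c' (pendant t)         ≡⟨ cong (A.value L.c' ∘ pendant) (pendant-∈⇒sign t (coincide-∈ y≋ y∈S)) ⟩
          A.value L.c' (pendant (sign S))  ≡⟨ L.value-pendant-c' ⟩
          L.m                              ∎)))
          where open ≡-Reasoning

    -- Otherwise S would be the face of the lift of e_u, which contains the point of the edge u w of G.
    embedded∈S : ∃ λ x → embed x Subset.∈ S
    embedded∈S with Finₚ.any? (λ x → embed x ∈? S)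
    ... | yes ∃x = ∃x
    ... | no ∄x = ⊥-elim (∄x (xu , subst (embed xu Subset.∈_) U-face≡S
                                          (U.∈face (ℚₚ.≤-reflexive (sym (U.value-embed-c' xu))))))
      where
      xu : Fin B.K
      xu = B.index u (proj₁ u~w) (proj₂ u~w)
      unit-max : B.Maximises (unit u) xu
      unit-max x = subst (B.value (unit u) x ≤_) (sym (B.value-unit-index u _ (proj₂ u~w))) (B.value-unit≤1 u x)
      0<1 : 0ℚ < B.value (unit u) xu
      0<1 = subst (0ℚ <_) (sym (B.value-unit-index u _ (proj₂ u~w))) (ℚₚ.positive⁻¹ 1ℚ)
      module U = Lift (unit u) xu unit-max 0<1 (sign S)
      U-face≡S : U.face ≡ S
      U-face≡S = liftFace≡S (unit u) xu unit-max 0<1 (λ x x∈S → ⊥-elim (∄x (x , x∈S)))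

    private
      x₀ : Fin B.K
      x₀ = proj₁ embedded∈S
      x₀∈ : embed x₀ Subset.∈ S
      x₀∈ = proj₂ embedded∈S

      x₀-max : B.Maximises b x₀
      x₀-max x = subst₂ _≤_ (value-embed a x) (value-embed a x₀) (to (S-face _) x₀∈ (embed x))

      0<bx₀ : 0ℚ < B.value b x₀
      0<bx₀ = subst (0ℚ <_) (value-embed a x₀) (0<value x₀∈)

    pendant-sign∈S : pendant (sign S) Subset.∈ S
    pendant-sign∈S = subst (pendant (sign S) Subset.∈_) face≡S L.pendant∈face
      where
      module L = Lift b x₀ x₀-max 0<bx₀ (sign S)
      face≡S : L.face ≡ S
      face≡S = liftFace≡S b x₀ x₀-max 0<bx₀ λ x x∈S →
        ℚₚ.≤-reflexive (trans (sym (value-embed a x₀)) (trans (same-value x₀∈ x∈S) (value-embed a x)))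

    ∈restrictFace : ∀ {x} → (x Subset.∈ restrictFace S) ⇔ (embed x Subset.∈ S)
    ∈restrictFace {x} = ∈-fromDec (λ x → embed x ∈? S) x

    restrictFace-isFaceBy : IsFaceBy B.points b (restrictFace S)
    restrictFace-isFaceBy x = mk⇔
      (λ x∈ x' → subst₂ _≤_ (value-embed a x') (value-embed a x) (to (S-face _) (to ∈restrictFace x∈) (embed x')))
      (λ x-max → from ∈restrictFace (from (S-face _) λ y → begin
        A.value a y                   ≤⟨ to (S-face _) pendant-sign∈S y ⟩
        A.value a (pendant (sign S))  ≡⟨ same-value pendant-sign∈S x₀∈ ⟩
        A.value a (embed x₀)          ≡⟨ value-embed a x₀ ⟩
        B.value b x₀                  ≤⟨ x-max x₀ ⟩
        B.value b x                   ≡⟨ value-embed a x ⟨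
        A.value a (embed x)           ∎))
      where open ℚₚ.≤-Reasoning

    restrictFace-proper : Proper B.points (restrictFace S)
    restrictFace-proper = B.opposite x₀ , λ opp∈ → 0<p⇒¬0<-p 0<bx₀
      (subst (0ℚ <_) (trans (value-embed a _) (B.value-opposite b x₀)) (0<value (to ∈restrictFace opp∈)))

    restrictFace-maximal : ∀ T → IsFace B.points T → Proper B.points T →
                           restrictFace S Subset.⊆ T → T ≡ restrictFace S
    restrictFace-maximal T (c , T-face) (z' , z'∉T) S'⊆T = ⊆-antisym T⊆S' S'⊆T
      where
      xc : Fin B.K
      xc = proj₁ (maximiser (B.value c) x₀)
      xc-max : B.Maximises c xc
      xc-max = proj₂ (maximiser (B.value c) x₀)
      0<cxc : 0ℚ < B.value c xc
      0<cxc = B.face-value-positive c T-face z'∉T (from (T-face xc) xc-max)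
      module L = Lift c xc xc-max 0<cxc (sign S)
      face≡S : L.face ≡ S
      face≡S = liftFace≡S c xc xc-max 0<cxc (λ x x∈S → to (T-face x) (S'⊆T (from ∈restrictFace x∈S)) xc)
      T⊆S' : T Subset.⊆ restrictFace S
      T⊆S' {x} x∈T = from ∈restrictFace
        (subst (embed x Subset.∈_) face≡S (L.∈face (subst (L.m ≤_) (sym (L.value-embed-c' x)) (to (T-face x) x∈T xc))))

    restrictFace-isFacet : IsFacet B.points (restrictFace S)
    restrictFace-isFacet = (b , restrictFace-isFaceBy) , restrictFace-proper , restrictFace-maximal

  module _ (u~w : ∃ λ w → adj G u w ≡ true) where

    private
      facet-⊆ : ∀ {S₁ S₂} (S₁-facet : IsFacet A.points S₁) (S₂-facet : IsFacet A.points S₂) →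
                restrictFace S₁ ≡ restrictFace S₂ → sign S₁ ≡ sign S₂ → S₁ Subset.⊆ S₂
      facet-⊆ {S₁} {S₂} S₁-facet S₂-facet S₁'≡S₂' σ₁≡σ₂ {y} y∈S₁ = by-shape (shape y)
        where
        module F₁ = Facet u~w S₁-facet
        module F₂ = Facet u~w S₂-facet
        by-shape : Shape y → y Subset.∈ S₂
        by-shape (embedded x y≋) = F₂.coincide-∈ (λ a → sym (y≋ a))
          (to F₂.∈restrictFace (subst (x Subset.∈_) S₁'≡S₂' (from F₁.∈restrictFace (F₁.coincide-∈ y≋ y∈S₁))))
        by-shape (pendantEdge t y≋) = F₂.coincide-∈ (λ a → sym (y≋ a))
          (subst (λ t → pendant t Subset.∈ S₂) (sym t≡σ₂) F₂.pendant-sign∈S)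
          where
          t≡σ₂ : t ≡ sign S₂
          t≡σ₂ = trans (F₁.pendant-∈⇒sign t (F₁.coincide-∈ y≋ y∈S₁)) σ₁≡σ₂

    facet-injective : ∀ {S₁ S₂} → IsFacet A.points S₁ → IsFacet A.points S₂ →
                      restrictFace S₁ ≡ restrictFace S₂ → sign S₁ ≡ sign S₂ → S₁ ≡ S₂
    facet-injective S₁-facet S₂-facet S₁'≡S₂' σ₁≡σ₂ =
      ⊆-antisym (facet-⊆ S₁-facet S₂-facet S₁'≡S₂' σ₁≡σ₂)
                (facet-⊆ S₂-facet S₁-facet (sym S₁'≡S₂') (sym σ₁≡σ₂))

open import Data.Bool using (Bool; true; false)
open import Data.Bool.Properties using (not-¬; ¬-not) renaming (_≟_ to _≟ᵇ_)
open import Data.Empty using (⊥-elim)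
open import Data.Fin as Fin using ()
open import Data.List using (List; []; _∷_; length)
open import Data.List.Relation.Unary.All using (All; []; _∷_)
open import Data.List.Relation.Unary.AllPairs using ([]; _∷_)
open import Data.List.Relation.Unary.Unique.Propositional using (Unique)
open import Data.Nat using (zero; _+_; _≤_; z≤n; s≤s)
open import Data.Nat.Properties using (≤-trans; ≤-reflexive; +-suc; +-mono-≤; +-identityʳ; suc-injective)
open import Data.Product using (∃; _,_)
open import Relation.Binary.PropositionalEquality
open import Relation.Nullary using (yes; no)
open GrowthOfM using (M-step)
open VertexDeletion using (deleteVertex; module Leaf)

module _ {A B : Set} {P : A → Set} {Q : B → Set} (f : A → B) (σ : A → Bool) (P⇒Q : ∀ {x} → P x → Q (f x))
         (injective : ∀ {x y} → P x → P y → f x ≡ f y → σ x ≡ σ y → x ≡ y) where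

  private
    fibre : Bool → List A → List B
    fibre b [] = []
    fibre b (x ∷ xs) with σ x ≟ᵇ b
    ... | yes _ = f x ∷ fibre b xs
    ... | no  _ = fibre b xs

    length≤fibres : ∀ xs → length xs ≤ length (fibre true xs) + length (fibre false xs)
    length≤fibres [] = z≤n
    length≤fibres (x ∷ xs) with σ x ≟ᵇ true | σ x ≟ᵇ false
    ... | yes _     | no _      = s≤s (length≤fibres xs)
    ... | no _      | yes _     = ≤-trans (s≤s (length≤fibres xs)) (≤-reflexive (sym (+-suc _ _)))
    ... | yes ≡true | yes ≡false = ⊥-elim (not-¬ ≡true ≡false)
    ... | no ≢true  | no ≢false  = ⊥-elim (≢false (¬-not ≢true))

    All-fibre : ∀ b {xs} → All P xs → All Q (fibre b xs)
    All-fibre b [] = []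
    All-fibre b {x ∷ xs} (px ∷ pxs) with σ x ≟ᵇ b
    ... | yes _ = P⇒Q px ∷ All-fibre b pxs
    ... | no  _ = All-fibre b pxs

    fibre-∌ : ∀ b {x} → P x → σ x ≡ b → ∀ {xs} → All P xs → All (x ≢_) xs → All (f x ≢_) (fibre b xs)
    fibre-∌ b px σx≡b [] [] = []
    fibre-∌ b px σx≡b {y ∷ xs} (py ∷ pxs) (x≢y ∷ x∉xs) with σ y ≟ᵇ b
    ... | yes σy≡b = (λ fx≡fy → x≢y (injective px py fx≡fy (trans σx≡b (sym σy≡b))))
                     ∷ fibre-∌ b px σx≡b pxs x∉xs
    ... | no  _    = fibre-∌ b px σx≡b pxs x∉xs

    Unique-fibre : ∀ b {xs} → All P xs → Unique xs → Unique (fibre b xs)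
    Unique-fibre b [] [] = []
    Unique-fibre b {x ∷ xs} (px ∷ pxs) (x∉xs ∷ uxs) with σ x ≟ᵇ b
    ... | yes σx≡b = fibre-∌ b px σx≡b pxs x∉xs ∷ Unique-fibre b pxs uxs
    ... | no  _    = Unique-fibre b pxs uxs

  length≤double : ∀ m → (∀ ys → Unique ys → All Q ys → length ys ≤ m) →
                  ∀ xs → Unique xs → All P xs → length xs ≤ m + m
  length≤double m bound xs uxs pxs = ≤-trans (length≤fibres xs)
    (+-mono-≤ (bound _ (Unique-fibre true pxs uxs) (All-fibre true pxs))
              (bound _ (Unique-fibre false pxs uxs) (All-fibre false pxs)))

neighbour-exists : ∀ {m} (H : Graph m) → Connected H → 2 ≤ m → ∀ x → ∃ λ y → adj H x y ≡ true
neighbour-exists {suc zero}    H conn (s≤s ()) x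
neighbour-exists {suc (suc k)} H conn _ x = first-step (conn x (other x)) (other≢ x)
  where
  other : Fin (suc (suc k)) → Fin (suc (suc k))
  other Fin.zero    = Fin.suc Fin.zero
  other (Fin.suc _) = Fin.zero
  other≢ : ∀ x → x ≢ other x
  other≢ Fin.zero    ()
  other≢ (Fin.suc _) ()
  first-step : ∀ {x y} → Reach H x y → x ≢ y → ∃ λ w → adj H x w ≡ true
  first-step here         x≢x = ⊥-elim (x≢x refl)
  first-step (step x~w _) _   = _ , x~w

numFacets-leaf : ∀ {n} (G' : Graph (suc n)) v → degree G' v ≡ 1 → Connected G' → 2 ≤ n → ∀ m →
  SEPFacets≤ (deleteVertex G' v) m → SEPFacets≤ G' (m + m)
numFacets-leaf G' v degree≡1 conn 2≤n m =
  length≤double restrictFace sign (Facet.restrictFace-isFacet u~w) (facet-injective u~w) m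
  where
  open LeafFacets G' v degree≡1
  open Leaf G' v degree≡1
  u~w : ∃ λ w → adj G u w ≡ true
  u~w = neighbour-exists G (connected-deleteLeaf conn) 2≤n u

corollary4p2 : (n : ℕ) → 3 ≤ n →
    ((G : Graph n) → Connected G → numEdges G ≡ n + 1 → SEPFacets≤ G (M n)) →
    (G' : Graph (suc n)) → Connected G' → numEdges G' ≡ n + 2 →
    ∃ (λ (v : Fin (suc n)) → degree G' v ≡ 1) →
    SEPFacets≤ G' (M (suc n))
corollary4p2 n 3≤n hypothesis G' conn numEdges≡n+2 (v , degree≡1) facets unique allFacets =
  ≤-trans (numFacets-leaf G' v degree≡1 conn 2≤n (M n) G-bound facets unique allFacets)
          (subst (_≤ M (suc n)) (cong (M n +_) (+-identityʳ (M n))) (M-step n 3≤n))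
  where
  open Leaf G' v degree≡1
  2≤n : 2 ≤ n
  2≤n = ≤-trans (s≤s (s≤s z≤n)) 3≤n
  numEdges≡n+1 : numEdges G ≡ n + 1
  numEdges≡n+1 = suc-injective (trans (sym numEdges-deleteLeaf) (trans numEdges≡n+2 (+-suc n 1)))
  G-bound : SEPFacets≤ G (M n)
  G-bound = hypothesis G (connected-deleteLeaf conn) numEdges≡n+1
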